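{- Let $n \ge 1$ and $k \ge 1$. Among all pairs $(T,v)$ with $T \in \mathcal{T}_n$ and $v$ a vertex of $T$, there are one-to-one correspondences between the following four sets: (i) pairs $(T,v)$ with $v$ a first-child of degree $k$; (ii) pairs $(T,v)$ with $v$ a non-first-child of degree $k$; (iii) pairs $(T,v)$ with $v$ a leaf having exactly $k-1$ elder siblings; (iv) pairs $(T,v)$ with $v$ a non-leaf of outdegree $k$. Moreover, the cardinality of each of these sets is $\binom{2n-k-1}{n-1}$.
   Context: $\mathcal{T}_n$ denotes the set of rooted ordered (plane) trees with $n$ edges. In such a tree, $v$ is a child of $u$ if $v$ is adjacent to $u$ and farther from the root; the root is not a child. Vertices with the same parent are siblings, ordered left to right; siblings to the left of $v$ are its elder siblings. The first-child is the leftmost among a set of siblings; a non-first-child is any vertex that is not a first-child (in particular the root). A leaf is a vertex with no children. The degree of a vertex is the number of incident edges; its outdegree is its number of children. -}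

module Defs where

open import Data.Nat using (ℕ; zero; suc; _+_; _*_; _∸_; _<?_)
open import Data.Nat.Combinatorics using (_C_)
open import Data.List using (List; []; _∷_; length; lookup)
open import Data.Fin using (Fin; toℕ)
open import Data.Product using (Σ; Σ-syntax; _×_)
open import Data.Empty using (⊥)
open import Data.Maybe using (Maybe; just; nothing)
open import Data.Unit using (⊤)
open import Relation.Nullary using (¬_; yes; no)
open import Relation.Binary.PropositionalEquality using (_≡_)

data Tree : Set where
  node : List Tree → Tree

mutual
  edges : Tree → ℕ
  edges (node ts) = edgesL ts

  edgesL : List Tree → ℕ
  edgesL []       = 0
  edgesL (t ∷ ts) = suc (edges t + edgesL ts)

-- Vertices of a tree, given as paths from the root:
-- 'here' is the root; 'child i p' is vertex p inside the i-th subtree.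
data Pos : Tree → Set where
  here  : ∀ {t} → Pos t
  child : ∀ {ts} (i : Fin (length ts)) → Pos (lookup ts i) → Pos (node ts)

kids : Tree → List Tree
kids (node ts) = ts

subtree : (t : Tree) → Pos t → Tree
subtree t here = t
subtree (node ts) (child i p) = subtree (lookup ts i) p

outdeg : {t : Tree} → Pos t → ℕ
outdeg {t} v = length (kids (subtree t v))

IsRoot : {t : Tree} → Pos t → Set
IsRoot here = ⊤
IsRoot (child _ _) = ⊥

-- degree = number of incident edges (children, plus parent edge if not root)
degree : {t : Tree} → Pos t → ℕ
degree {t} here = outdeg {t} here
degree {t} (child i p) = suc (outdeg {t} (child i p))

-- position of a vertex among its siblings (0 = leftmost);
-- 'nothing' for the root, which has no parent
sibIndex : {t : Tree} → Pos t → Maybe ℕ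
sibIndex here = nothing
sibIndex (child i p) with sibIndex p
... | nothing = just (toℕ i)
... | just m  = just m

-- number of elder siblings (0 for the root, which has no siblings)
elder : {t : Tree} → Pos t → ℕ
elder v with sibIndex v
... | nothing = 0
... | just m  = m

IsFirstChild : {t : Tree} → Pos t → Set
IsFirstChild v = sibIndex v ≡ just 0

IsLeaf : {t : Tree} → Pos t → Set
IsLeaf v = outdeg v ≡ 0

FirstChildDeg : ℕ → {t : Tree} → Pos t → Set
FirstChildDeg k v = IsFirstChild v × degree v ≡ k

NonFirstChildDeg : ℕ → {t : Tree} → Pos t → Set
NonFirstChildDeg k v = ¬ IsFirstChild v × degree v ≡ k

LeafElder : ℕ → {t : Tree} → Pos t → Set
LeafElder k v = IsLeaf v × elder v ≡ k ∸ 1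

NonLeafOutdeg : ℕ → {t : Tree} → Pos t → Set
NonLeafOutdeg k v = ¬ IsLeaf v × outdeg v ≡ k

Pairs : ℕ → ({t : Tree} → Pos t → Set) → Set
Pairs n P = Σ[ T ∈ Tree ] (edges T ≡ n × Σ[ v ∈ Pos T ] P v)

-- binom(2n-k-1, n-1), with the standard convention that a binomial
-- coefficient with negative upper index (here: k ≥ 2n) is 0.
binom2n-k-1 : ℕ → ℕ → ℕ
binom2n-k-1 n k with k <? 2 * n
... | yes _ = (2 * n ∸ k ∸ 1) C (n ∸ 1)
... | no  _ = 0

-- A vertex of a plane tree is the same as a zipper: the context around it together with the
-- subtree rooted at it. In zipper form each of the four classes is in bijection with the vertices
-- of outdegree k: a first child of degree k swaps places with its parent, which keeps the younger
-- siblings; a non-first child of degree k adopts its nearest elder sibling as its first child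
-- (the root is left alone); a leaf with k − 1 elder siblings is replaced, at its parent's place,
-- by a vertex whose children are a new vertex carrying the younger siblings followed by the elder
-- siblings, nearest first. Vertices of outdegree k are counted by the recursion behind Pascal's
-- rule for C(2n−k−1, n−1): the first child of the marked vertex is either a leaf, which is
-- deleted, or it hands its own first child up to the marked vertex.

module Submission where

open import Defs
open import Axiom.UniquenessOfIdentityProofs.WithK using (uip)
open import Data.Empty using (⊥-elim)
open import Data.Fin using (Fin; zero; suc; toℕ)
open import Data.Fin.Properties using (+↔⊎)
open import Data.List using (List; []; _∷_; length; lookup; _ʳ++_; _++_)
open import Data.List.Properties using (++-identityʳ)
open import Data.Maybe using (Maybe; just; nothing; fromMaybe)
open import Data.Nat using (ℕ; zero; suc; _+_; _*_; _∸_; _≤_; _<_; _≤?_; _<?_; z≤n; s≤s; z<s)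
open import Data.Nat.Combinatorics using (_C_; nCk≡nC[n∸k]; nCk+nC[k+1]≡[n+1]C[k+1]; k>n⇒nCk≡0)
open import Data.Nat.Properties
  using (+-suc; +-identityʳ; suc-injective; 0≢1+n; ≤-pred; ≤-trans; m≤n+m; m≤m+n; <⇒≱; ≰⇒>;
         m<m+n; +-monoʳ-<; +-cancelʳ-<; m+n∸n≡m; m+n∸m≡n; m∸n+n≡m)
open import Data.Nat.Tactic.RingSolver using (solve-∀)
open import Data.Product using (Σ; _×_; _,_; proj₁; proj₂)
open import Data.Product.Function.Dependent.Propositional using (Σ-↔)
open import Data.Product.Function.NonDependent.Propositional using (_×-↔_)
open import Data.Sum using (_⊎_; inj₁; inj₂)
open import Data.Sum.Function.Propositional using (_⊎-↔_)
open import Function.Base using (_∘_)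
open import Function.Bundles using (_↔_; mk↔ₛ′)
open import Function.Properties.Inverse using (↔-refl; ↔-sym; ↔-trans)
open import Relation.Binary.PropositionalEquality
open import Relation.Nullary using (¬_; yes; no)
open import Relation.Nullary.Irrelevant using (Irrelevant)

-- Zippers

-- The elder siblings of the hole are listed nearest first.
data Context : Set where
  root  : Context
  below : Context → (elders youngers : List Tree) → Context

plug : Context → Tree → Tree
plug root s = s
plug (below c ls rs) s = plug c (node (ls ʳ++ s ∷ rs))

ChildPos : List Tree → Set
ChildPos ts = Σ (Fin (length ts)) (λ i → Pos (lookup ts i))

toChild : ∀ {ts} → ChildPos ts → Pos (node ts)
toChild (i , p) = child i p

shift : (ls : List Tree) {ys : List Tree} → ChildPos ys → ChildPos (ls ʳ++ ys)
shift []       q       = q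
shift (l ∷ ls) (i , p) = shift ls (suc i , p)

embed : (c : Context) {t : Tree} → Pos t → Pos (plug c t)
embed root p = p
embed (below c ls rs) p = embed c (toChild (shift ls (zero , p)))

focus : (c : Context) (s : Tree) → Pos (plug c s)
focus c s = embed c here

mutual
  unplug : Context → (t : Tree) → Pos t → Context × Tree
  unplug c t here = c , t
  unplug c (node ts) (child i p) = unplugAt c [] ts i p

  unplugAt : Context → (ls ts : List Tree) (i : Fin (length ts)) → Pos (lookup ts i) → Context × Tree
  unplugAt c ls (t ∷ ts) zero    p = unplug (below c ls ts) t p
  unplugAt c ls (t ∷ ts) (suc i) p = unplugAt c (t ∷ ls) ts i p

toZipper : Σ Tree Pos → Context × Tree
toZipper (t , p) = unplug root t p

fromZipper : Context × Tree → Σ Tree Pos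
fromZipper (c , s) = plug c s , focus c s

mutual
  fromZipper-unplug : ∀ c t (p : Pos t) → fromZipper (unplug c t p) ≡ (plug c t , embed c p)
  fromZipper-unplug c t here = refl
  fromZipper-unplug c (node ts) (child i p) = fromZipper-unplugAt c [] ts i p

  fromZipper-unplugAt : ∀ c ls ts i p → fromZipper (unplugAt c ls ts i p)
                      ≡ (plug c (node (ls ʳ++ ts)) , embed c (toChild (shift ls (i , p))))
  fromZipper-unplugAt c ls (t ∷ ts) zero    p = fromZipper-unplug (below c ls ts) t p
  fromZipper-unplugAt c ls (t ∷ ts) (suc i) p = fromZipper-unplugAt c (t ∷ ls) ts i p

infixl 5 _++ᶜ_
_++ᶜ_ : Context → Context → Context
c₀ ++ᶜ root = c₀
c₀ ++ᶜ below c ls rs = below (c₀ ++ᶜ c) ls rs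

root-++ᶜ : ∀ c → root ++ᶜ c ≡ c
root-++ᶜ root = refl
root-++ᶜ (below c ls rs) = cong (λ c′ → below c′ ls rs) (root-++ᶜ c)

unplugAt-shift : ∀ c acc ls ys i p →
  unplugAt c acc (ls ʳ++ ys) (proj₁ (shift ls (i , p))) (proj₂ (shift ls (i , p)))
  ≡ unplugAt c (ls ++ acc) ys i p
unplugAt-shift c acc []       ys i p = refl
unplugAt-shift c acc (l ∷ ls) ys i p = unplugAt-shift c acc ls (l ∷ ys) (suc i) p

unplug-embed : ∀ c₀ c t (p : Pos t) → unplug c₀ (plug c t) (embed c p) ≡ unplug (c₀ ++ᶜ c) t p
unplug-embed c₀ root t p = refl
unplug-embed c₀ (below c ls rs) t p = begin
  unplug c₀ (plug c _) (embed c _)            ≡⟨ unplug-embed c₀ c _ _ ⟩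
  unplugAt (c₀ ++ᶜ c) [] (ls ʳ++ t ∷ rs) _ _   ≡⟨ unplugAt-shift (c₀ ++ᶜ c) [] ls (t ∷ rs) zero p ⟩
  unplug (below (c₀ ++ᶜ c) (ls ++ []) rs) t p ≡⟨ cong (λ ls′ → unplug (below (c₀ ++ᶜ c) ls′ rs) t p)
                                                      (++-identityʳ ls) ⟩
  unplug (below (c₀ ++ᶜ c) ls rs) t p         ∎
  where open ≡-Reasoning

toZipper-fromZipper : ∀ z → toZipper (fromZipper z) ≡ z
toZipper-fromZipper (c , s) = trans (unplug-embed root c s here) (cong (_, s) (root-++ᶜ c))

fromZipper-toZipper : ∀ x → fromZipper (toZipper x) ≡ x
fromZipper-toZipper (t , p) = fromZipper-unplug root t p

pointed↔zipper : Σ Tree Pos ↔ (Context × Tree)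
pointed↔zipper = mk↔ₛ′ toZipper fromZipper toZipper-fromZipper fromZipper-toZipper

ctxEdges : Context → ℕ
ctxEdges root = 0
ctxEdges (below c ls rs) = suc (ctxEdges c + edgesL ls + edgesL rs)

edgesL-ʳ++ : ∀ ls ys → edgesL (ls ʳ++ ys) ≡ edgesL ls + edgesL ys
edgesL-ʳ++ []       ys = refl
edgesL-ʳ++ (l ∷ ls) ys = trans (edgesL-ʳ++ ls (l ∷ ys)) (rearrange (edgesL ls) (edges l) (edgesL ys))
  where
  rearrange : ∀ a b c → a + suc (b + c) ≡ suc (b + a) + c
  rearrange = solve-∀

edges-plug : ∀ c s → edges (plug c s) ≡ ctxEdges c + edges s
edges-plug root s = refl
edges-plug (below c ls rs) s = begin
  edges (plug c (node (ls ʳ++ s ∷ rs)))          ≡⟨ edges-plug c _ ⟩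
  ctxEdges c + edgesL (ls ʳ++ s ∷ rs)            ≡⟨ cong (ctxEdges c +_) (edgesL-ʳ++ ls (s ∷ rs)) ⟩
  ctxEdges c + (edgesL ls + suc (edges s + edgesL rs))
    ≡⟨ rearrange (ctxEdges c) (edgesL ls) (edges s) (edgesL rs) ⟩
  suc (ctxEdges c + edgesL ls + edgesL rs) + edges s ∎
  where
  open ≡-Reasoning
  rearrange : ∀ a b x d → a + (b + suc (x + d)) ≡ suc (a + b + d) + x
  rearrange = solve-∀

shift-invariant : {A : Set} (f : ∀ {t} → Pos t → A) (ls : List Tree) {ys : List Tree}
                  (i : Fin (length ys)) (p : Pos (lookup ys i)) →
                  f (proj₂ (shift ls {ys} (i , p))) ≡ f p
shift-invariant f []       i p = refl
shift-invariant f (l ∷ ls) {ys} i p = shift-invariant f ls {l ∷ ys} (suc i) p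

toℕ-shift : ∀ ls {ys : List Tree} (i : Fin (length ys)) p →
            toℕ (proj₁ (shift ls {ys} (i , p))) ≡ length ls + toℕ i
toℕ-shift []       i p = refl
toℕ-shift (l ∷ ls) {ys} i p = trans (toℕ-shift ls {l ∷ ys} (suc i) p) (+-suc (length ls) (toℕ i))

subtree-embed : ∀ c {t} (p : Pos t) → subtree (plug c t) (embed c p) ≡ subtree t p
subtree-embed root p = refl
subtree-embed (below c ls rs) {t} p =
  trans (subtree-embed c (toChild (shift ls (zero , p))))
        (shift-invariant (λ {t′} → subtree t′) ls {t ∷ rs} zero p)

outdeg-focus : ∀ c s → outdeg (focus c s) ≡ length (kids s)
outdeg-focus c s = cong (length ∘ kids) (subtree-embed c {s} here)

sibIndex-child : ∀ {ts} (i : Fin (length ts)) (p : Pos (lookup ts i)) →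
                 sibIndex (child {ts} i p) ≡ just (fromMaybe (toℕ i) (sibIndex p))
sibIndex-child i p with sibIndex p
... | nothing = refl
... | just m  = refl

sibIndex-shift : ∀ ls {ys : List Tree} (i : Fin (length ys)) (p : Pos (lookup ys i)) →
                 sibIndex (toChild {ls ʳ++ ys} (shift ls (i , p)))
                 ≡ just (fromMaybe (length ls + toℕ i) (sibIndex p))
sibIndex-shift ls {ys} i p = begin
  sibIndex (child {ls ʳ++ ys} i′ p′)                ≡⟨ sibIndex-child {ls ʳ++ ys} i′ p′ ⟩
  just (fromMaybe (toℕ i′) (sibIndex p′))           ≡⟨ cong₂ (λ j q → just (fromMaybe j q))
                                                             (toℕ-shift ls i p)
                                                             (shift-invariant sibIndex ls i p) ⟩
  just (fromMaybe (length ls + toℕ i) (sibIndex p)) ∎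
  where
  open ≡-Reasoning
  i′ = proj₁ (shift ls {ys} (i , p))
  p′ = proj₂ (shift ls {ys} (i , p))

sibIndex-embed : ∀ c {t} (p : Pos t) {m} → sibIndex p ≡ just m → sibIndex (embed c p) ≡ just m
sibIndex-embed root p eq = eq
sibIndex-embed (below c ls rs) {t} p eq =
  sibIndex-embed c (toChild {ls ʳ++ t ∷ rs} _)
    (trans (sibIndex-shift ls zero p) (cong (just ∘ fromMaybe _) eq))

holeSibIndex : Context → Maybe ℕ
holeSibIndex root = nothing
holeSibIndex (below _ ls _) = just (length ls)

sibIndex-focus : ∀ c s → sibIndex (focus c s) ≡ holeSibIndex c
sibIndex-focus root s = refl
sibIndex-focus (below c ls rs) s =
  sibIndex-embed c (toChild {ls ʳ++ s ∷ rs} _)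
    (trans (sibIndex-shift ls zero here) (cong just (+-identityʳ (length ls))))

elder≡fromMaybe : ∀ {t} (v : Pos t) → elder v ≡ fromMaybe 0 (sibIndex v)
elder≡fromMaybe v with sibIndex v
... | nothing = refl
... | just m  = refl

elder-focus : ∀ c s → elder (focus c s) ≡ fromMaybe 0 (holeSibIndex c)
elder-focus c s = trans (elder≡fromMaybe (focus c s)) (cong (fromMaybe 0) (sibIndex-focus c s))

degree-embed-child : ∀ c {ts} (i : Fin (length ts)) (p : Pos (lookup ts i)) →
                     degree (embed c (child {ts} i p)) ≡ suc (outdeg (embed c (child {ts} i p)))
degree-embed-child root i p = refl
degree-embed-child (below c ls rs) i p = degree-embed-child c _ _

parentEdge : Context → ℕ
parentEdge root = 0
parentEdge (below _ _ _) = 1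

degree-focus : ∀ c s → degree (focus c s) ≡ parentEdge c + length (kids s)
degree-focus root s = refl
degree-focus (below c ls rs) s =
  trans (degree-embed-child c _ _) (cong suc (outdeg-focus (below c ls rs) s))

-- The four classes in zipper form

Zipped : ℕ → (Context → Tree → Set) → Set
Zipped n Q = Σ (Context × Tree) (λ (c , s) → ctxEdges c + edges s ≡ n × Q c s)

Pairs↔Zipped : {P : ∀ {t} → Pos t → Set} {Q : Context → Tree → Set} →
               (∀ c s → P (focus c s) ↔ Q c s) → ∀ n → Pairs n P ↔ Zipped n Q
Pairs↔Zipped {P} {Q} P↔Q n = ↔-trans regroup (Σ-↔ pointed↔zipper fibre)
  where
  Fibre : Σ Tree Pos → Set
  Fibre (t , v) = edges t ≡ n × P v

  regroup : Pairs n P ↔ Σ (Σ Tree Pos) Fibre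
  regroup = mk↔ₛ′ (λ (t , e , v , p) → (t , v) , e , p) (λ ((t , v) , e , p) → t , e , v , p)
                  (λ _ → refl) (λ _ → refl)

  ZippedFibre : Context × Tree → Set
  ZippedFibre (c , s) = ctxEdges c + edges s ≡ n × Q c s

  transport : ∀ {A : Set} (F : A → Set) {x y} → x ≡ y → F x ↔ F y
  transport F refl = ↔-refl

  fibre : ∀ {x} → Fibre x ↔ ZippedFibre (toZipper x)
  fibre {x} = ↔-trans (transport Fibre (sym (fromZipper-toZipper x)))
                      (transport (_≡ n) (edges-plug c s) ×-↔ P↔Q c s)
    where
    c = proj₁ (toZipper x)
    s = proj₂ (toZipper x)

FirstChildDegᶻ NonFirstChildDegᶻ LeafElderᶻ NonLeafOutdegᶻ : ℕ → Context → Tree → Set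
FirstChildDegᶻ    k c s = holeSibIndex c ≡ just 0 × parentEdge c + length (kids s) ≡ k
NonFirstChildDegᶻ k c s = ¬ holeSibIndex c ≡ just 0 × parentEdge c + length (kids s) ≡ k
LeafElderᶻ        k c s = length (kids s) ≡ 0 × fromMaybe 0 (holeSibIndex c) ≡ k ∸ 1
NonLeafOutdegᶻ    k c s = ¬ length (kids s) ≡ 0 × length (kids s) ≡ k

firstChildDeg-focus : ∀ k c s → FirstChildDeg k (focus c s) ↔ FirstChildDegᶻ k c s
firstChildDeg-focus k c s rewrite sibIndex-focus c s | degree-focus c s = ↔-refl

nonFirstChildDeg-focus : ∀ k c s → NonFirstChildDeg k (focus c s) ↔ NonFirstChildDegᶻ k c s
nonFirstChildDeg-focus k c s rewrite sibIndex-focus c s | degree-focus c s = ↔-refl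

leafElder-focus : ∀ k c s → LeafElder k (focus c s) ↔ LeafElderᶻ k c s
leafElder-focus k c s rewrite outdeg-focus c s | elder-focus c s = ↔-refl

nonLeafOutdeg-focus : ∀ k c s → NonLeafOutdeg k (focus c s) ↔ NonLeafOutdegᶻ k c s
nonLeafOutdeg-focus k c s rewrite outdeg-focus c s = ↔-refl

-- Each class as the vertices of outdegree k

Σ-≡-irrelevant : {A : Set} {B : A → Set} → (∀ x → Irrelevant (B x)) →
                 {p q : Σ A B} → proj₁ p ≡ proj₁ q → p ≡ q
Σ-≡-irrelevant B-irr {x , b} {.x , b′} refl = cong (x ,_) (B-irr x b b′)

×-irrelevant : {A B : Set} → Irrelevant A → Irrelevant B → Irrelevant (A × B)
×-irrelevant irrA irrB (a , b) (a′ , b′) = cong₂ _,_ (irrA a a′) (irrB b b′)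

-- ⊥ is definitionally proof-irrelevant in the standard library
¬-irrelevant : {A : Set} → Irrelevant (¬ A)
¬-irrelevant _ _ = refl

MarkedOutdeg : ℕ → ℕ → Set
MarkedOutdeg n k =
  Σ (Context × List Tree) (λ (c , ts) → ctxEdges c + edgesL ts ≡ n × length ts ≡ k)

markedOutdeg-≡ : ∀ {n k} {x y : MarkedOutdeg n k} → proj₁ x ≡ proj₁ y → x ≡ y
markedOutdeg-≡ = Σ-≡-irrelevant (λ _ → ×-irrelevant uip uip)

zipped-≡ : ∀ {n Q} → (∀ c s → Irrelevant (Q c s)) →
           {x y : Zipped n Q} → proj₁ x ≡ proj₁ y → x ≡ y
zipped-≡ Q-irr = Σ-≡-irrelevant (λ (c , s) → ×-irrelevant uip (Q-irr c s))

firstChildDegᶻ↔markedOutdeg : ∀ n k → Zipped n (FirstChildDegᶻ (suc k)) ↔ MarkedOutdeg n (suc k)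
firstChildDegᶻ↔markedOutdeg n k = mk↔ₛ′ to from
  (λ { ((c , node rs ∷ ts) , _) → markedOutdeg-≡ refl })
  (λ { ((below c [] rs , node ts) , _ , refl , _) → zipped-≡ (λ _ _ → ×-irrelevant uip uip) refl })
  where
  rearrange : ∀ a r t → suc (a + 0 + r) + t ≡ a + suc (r + t)
  rearrange = solve-∀
  to : Zipped n (FirstChildDegᶻ (suc k)) → MarkedOutdeg n (suc k)
  to ((below c [] rs , node ts) , e , refl , d) =
    (c , node rs ∷ ts) , trans (sym (rearrange (ctxEdges c) (edgesL rs) (edgesL ts))) e , d
  from : MarkedOutdeg n (suc k) → Zipped n (FirstChildDegᶻ (suc k))
  from ((c , node rs ∷ ts) , e , d) =
    (below c [] rs , node ts) , trans (rearrange (ctxEdges c) (edgesL rs) (edgesL ts)) e , refl , d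

nonFirstChildDegᶻ↔markedOutdeg : ∀ n k →
  Zipped n (NonFirstChildDegᶻ (suc k)) ↔ MarkedOutdeg n (suc k)
nonFirstChildDegᶻ↔markedOutdeg n k = mk↔ₛ′ to from
  (λ { ((root , ts) , _) → refl ; ((below c ls rs , y ∷ ts) , _) → markedOutdeg-≡ refl })
  (λ { ((root , node ts) , _) → refl
     ; ((below c [] rs , s) , _ , nonFirst , _) → ⊥-elim (nonFirst refl)
     ; ((below c (y ∷ ls) rs , node ts) , _) →
         zipped-≡ (λ _ _ → ×-irrelevant ¬-irrelevant uip) refl })
  where
  rearrange : ∀ a y l r t → suc (a + suc (y + l) + r) + t ≡ suc (a + l + r) + suc (y + t)
  rearrange = solve-∀
  to : Zipped n (NonFirstChildDegᶻ (suc k)) → MarkedOutdeg n (suc k)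
  to ((root , node ts) , e , _ , d) = (root , ts) , e , d
  to ((below c [] rs , s) , _ , nonFirst , _) = ⊥-elim (nonFirst refl)
  to ((below c (y ∷ ls) rs , node ts) , e , _ , d) =
    (below c ls rs , y ∷ ts) ,
    trans (sym (rearrange (ctxEdges c) (edges y) (edgesL ls) (edgesL rs) (edgesL ts))) e , d
  from : MarkedOutdeg n (suc k) → Zipped n (NonFirstChildDegᶻ (suc k))
  from ((root , ts) , e , d) = (root , node ts) , e , (λ ()) , d
  from ((below c ls rs , y ∷ ts) , e , d) =
    (below c (y ∷ ls) rs , node ts) ,
    trans (rearrange (ctxEdges c) (edges y) (edgesL ls) (edgesL rs) (edgesL ts)) e , (λ ()) , d

-- For n = 0 the root of the one-vertex tree is a leaf without a parent.
leafElderᶻ↔markedOutdeg : ∀ n k →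
  Zipped (suc n) (LeafElderᶻ (suc k)) ↔ MarkedOutdeg (suc n) (suc k)
leafElderᶻ↔markedOutdeg n k = mk↔ₛ′ to from
  (λ { ((c , node rs ∷ ls) , _) → markedOutdeg-≡ refl })
  (λ { ((below c ls rs , node []) , _ , refl , _) → zipped-≡ (λ _ _ → ×-irrelevant uip uip) refl })
  where
  rearrange : ∀ a l r → suc (a + l + r) + 0 ≡ a + suc (r + l)
  rearrange = solve-∀
  to : Zipped (suc n) (LeafElderᶻ (suc k)) → MarkedOutdeg (suc n) (suc k)
  to ((below c ls rs , node []) , e , refl , d) =
    (c , node rs ∷ ls) , trans (sym (rearrange (ctxEdges c) (edgesL ls) (edgesL rs))) e , cong suc d
  from : MarkedOutdeg (suc n) (suc k) → Zipped (suc n) (LeafElderᶻ (suc k))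
  from ((c , node rs ∷ ls) , e , d) =
    (below c ls rs , node []) ,
    trans (rearrange (ctxEdges c) (edgesL ls) (edgesL rs)) e , refl , suc-injective d

nonLeafOutdegᶻ↔markedOutdeg : ∀ n k →
  Zipped n (NonLeafOutdegᶻ (suc k)) ↔ MarkedOutdeg n (suc k)
nonLeafOutdegᶻ↔markedOutdeg n k = mk↔ₛ′
  (λ { ((c , node ts) , e , _ , d) → (c , ts) , e , d })
  (λ ((c , ts) , e , d) → (c , node ts) , e , (λ leaf → 0≢1+n (trans (sym leaf) d)) , d)
  (λ _ → refl) (λ { ((c , node ts) , _) → refl })

firstChildDeg↔markedOutdeg : ∀ n k → Pairs n (FirstChildDeg (suc k)) ↔ MarkedOutdeg n (suc k)
firstChildDeg↔markedOutdeg n k =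
  ↔-trans (Pairs↔Zipped (firstChildDeg-focus (suc k)) n) (firstChildDegᶻ↔markedOutdeg n k)

nonFirstChildDeg↔markedOutdeg : ∀ n k → Pairs n (NonFirstChildDeg (suc k)) ↔ MarkedOutdeg n (suc k)
nonFirstChildDeg↔markedOutdeg n k =
  ↔-trans (Pairs↔Zipped (nonFirstChildDeg-focus (suc k)) n) (nonFirstChildDegᶻ↔markedOutdeg n k)

leafElder↔markedOutdeg : ∀ n k → Pairs (suc n) (LeafElder (suc k)) ↔ MarkedOutdeg (suc n) (suc k)
leafElder↔markedOutdeg n k =
  ↔-trans (Pairs↔Zipped (leafElder-focus (suc k)) (suc n)) (leafElderᶻ↔markedOutdeg n k)

nonLeafOutdeg↔markedOutdeg : ∀ n k → Pairs n (NonLeafOutdeg (suc k)) ↔ MarkedOutdeg n (suc k)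
nonLeafOutdeg↔markedOutdeg n k =
  ↔-trans (Pairs↔Zipped (nonLeafOutdeg-focus (suc k)) n) (nonLeafOutdegᶻ↔markedOutdeg n k)

-- Counting vertices of outdegree k

markedOutdeg-suc-suc : ∀ n k →
  MarkedOutdeg (suc n) (suc k) ↔ (MarkedOutdeg n k ⊎ MarkedOutdeg (suc n) (suc (suc k)))
markedOutdeg-suc-suc n k = mk↔ₛ′ to from
  (λ { (inj₁ _) → cong inj₁ (markedOutdeg-≡ refl)
     ; (inj₂ ((c , z ∷ node zs ∷ ts) , _)) → cong inj₂ (markedOutdeg-≡ refl) })
  (λ { ((c , node [] ∷ ts) , _) → markedOutdeg-≡ refl
     ; ((c , node (z ∷ zs) ∷ ts) , _) → markedOutdeg-≡ refl })
  where
  rearrange : ∀ a z y t → a + suc (suc (z + y) + t) ≡ a + suc (z + suc (y + t))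
  rearrange = solve-∀
  to : MarkedOutdeg (suc n) (suc k) → MarkedOutdeg n k ⊎ MarkedOutdeg (suc n) (suc (suc k))
  to ((c , node [] ∷ ts) , e , d) =
    inj₁ ((c , ts) , suc-injective (trans (sym (+-suc (ctxEdges c) (edgesL ts))) e) , suc-injective d)
  to ((c , node (z ∷ zs) ∷ ts) , e , d) =
    inj₂ ((c , z ∷ node zs ∷ ts) ,
          trans (sym (rearrange (ctxEdges c) (edges z) (edgesL zs) (edgesL ts))) e , cong suc d)
  from : MarkedOutdeg n k ⊎ MarkedOutdeg (suc n) (suc (suc k)) → MarkedOutdeg (suc n) (suc k)
  from (inj₁ ((c , ts) , e , d)) =
    (c , node [] ∷ ts) , trans (+-suc (ctxEdges c) (edgesL ts)) (cong suc e) , cong suc d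
  from (inj₂ ((c , z ∷ node zs ∷ ts) , e , d)) =
    (c , node (z ∷ zs) ∷ ts) ,
    trans (rearrange (ctxEdges c) (edges z) (edgesL zs) (edgesL ts)) e , suc-injective d

-- A marked leaf that is a first child swaps places with its parent. Otherwise the parent becomes
-- the marked vertex, with three children: a new vertex carrying the remaining elder siblings, a
-- new vertex carrying the younger siblings, and the nearest elder sibling of the leaf.
markedOutdeg-suc-zero : ∀ n →
  MarkedOutdeg (suc n) 0 ↔ (MarkedOutdeg (suc n) 1 ⊎ MarkedOutdeg (suc (suc n)) 3)
markedOutdeg-suc-zero n = mk↔ₛ′ to from
  (λ { (inj₁ ((c , node rs ∷ []) , _ , refl)) → cong inj₁ (markedOutdeg-≡ refl)
     ; (inj₂ ((c , node ls ∷ node rs ∷ x ∷ []) , _ , refl)) → cong inj₂ (markedOutdeg-≡ refl) })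
  (λ { ((below c [] rs , []) , _) → markedOutdeg-≡ refl
     ; ((below c (x ∷ ls) rs , []) , _) → markedOutdeg-≡ refl })
  where
  rearrange₁ : ∀ a r → suc (a + 0 + r) + 0 ≡ a + suc (r + 0)
  rearrange₁ = solve-∀
  rearrange₃ : ∀ a x l r → suc (suc (a + suc (x + l) + r) + 0) ≡ a + suc (l + suc (r + suc (x + 0)))
  rearrange₃ = solve-∀
  to : MarkedOutdeg (suc n) 0 → MarkedOutdeg (suc n) 1 ⊎ MarkedOutdeg (suc (suc n)) 3
  to ((below c [] rs , []) , e , _) =
    inj₁ ((c , node rs ∷ []) , trans (sym (rearrange₁ (ctxEdges c) (edgesL rs))) e , refl)
  to ((below c (x ∷ ls) rs , []) , e , _) =
    inj₂ ((c , node ls ∷ node rs ∷ x ∷ []) ,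
          trans (sym (rearrange₃ (ctxEdges c) (edges x) (edgesL ls) (edgesL rs))) (cong suc e) , refl)
  from : MarkedOutdeg (suc n) 1 ⊎ MarkedOutdeg (suc (suc n)) 3 → MarkedOutdeg (suc n) 0
  from (inj₁ ((c , node rs ∷ []) , e , _)) =
    (below c [] rs , []) , trans (rearrange₁ (ctxEdges c) (edgesL rs)) e , refl
  from (inj₂ ((c , node ls ∷ node rs ∷ x ∷ []) , e , _)) =
    (below c (x ∷ ls) rs , []) ,
    suc-injective (trans (rearrange₃ (ctxEdges c) (edges x) (edgesL ls) (edgesL rs)) e) , refl

length≤edgesL : ∀ ts → length ts ≤ edgesL ts
length≤edgesL [] = z≤n
length≤edgesL (t ∷ ts) = s≤s (≤-trans (length≤edgesL ts) (m≤n+m (edgesL ts) (edges t)))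

markedOutdeg-empty : ∀ {n k} → n < k → ¬ MarkedOutdeg n k
markedOutdeg-empty n<k ((c , ts) , refl , refl) =
  <⇒≱ n<k (≤-trans (length≤edgesL ts) (m≤n+m (edgesL ts) (ctxEdges c)))

markedOutdeg-zero-zero : MarkedOutdeg 0 0 ↔ Fin 1
markedOutdeg-zero-zero = mk↔ₛ′ (λ _ → zero) (λ _ → (root , []) , refl , refl)
                                (λ { zero → refl }) (λ { ((root , []) , refl , refl) → refl })

2*n≡n+n : ∀ n → 2 * n ≡ n + n
2*n≡n+n n = cong (n +_) (+-identityʳ n)

binom2n-k-1-< : ∀ n k → k < 2 * n → binom2n-k-1 n k ≡ (2 * n ∸ k ∸ 1) C (n ∸ 1)
binom2n-k-1-< n k k<2n with k <? 2 * n
... | yes _   = refl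
... | no k≮2n = ⊥-elim (k≮2n k<2n)

binom2n-k-1-complement : ∀ a m k → m + k ≡ a + suc a → binom2n-k-1 (suc a) k ≡ m C a
binom2n-k-1-complement a m k m+k≡2a+1 = begin
  binom2n-k-1 (suc a) k   ≡⟨ binom2n-k-1-< (suc a) k k<2[1+a] ⟩
  (2 * suc a ∸ k ∸ 1) C a ≡⟨ cong (λ x → (x ∸ k ∸ 1) C a) 2[1+a]≡1+m+k ⟩
  (suc m + k ∸ k ∸ 1) C a ≡⟨ cong (λ x → (x ∸ 1) C a) (m+n∸n≡m (suc m) k) ⟩
  m C a                   ∎
  where
  open ≡-Reasoning
  2[1+a]≡1+m+k : 2 * suc a ≡ suc m + k
  2[1+a]≡1+m+k = trans (2*n≡n+n (suc a)) (cong suc (sym m+k≡2a+1))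
  k<2[1+a] : k < 2 * suc a
  k<2[1+a] = subst (k <_) (sym 2[1+a]≡1+m+k) (s≤s (m≤n+m k m))

binom2n-k-1-≥ : ∀ n k → 2 * n ≤ k → binom2n-k-1 n k ≡ 0
binom2n-k-1-≥ n k 2n≤k with k <? 2 * n
... | yes k<2n = ⊥-elim (<⇒≱ k<2n 2n≤k)
... | no _     = refl

-- binom2n-k-1 0 0 is 0, but the one-vertex tree has a vertex of outdegree 0
count : ℕ → ℕ → ℕ
count zero    zero    = 1
count zero    (suc k) = 0
count (suc n) k       = binom2n-k-1 (suc n) k

count-suc-suc : ∀ n k → k ≤ n → count (suc n) (suc k) ≡ count n k + count (suc n) (suc (suc k))
count-suc-suc zero    zero    _   = refl
count-suc-suc (suc b) k       k≤n = begin
  binom2n-k-1 (suc (suc b)) (suc k)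
    ≡⟨ binom2n-k-1-complement (suc b) (suc m) (suc k) (cong suc m+1+k≡b+2+b) ⟩
  suc m C suc b
    ≡⟨ sym (nCk+nC[k+1]≡[n+1]C[k+1] m b) ⟩
  m C b + m C suc b
    ≡⟨ sym (cong₂ _+_ (binom2n-k-1-complement b m k m+k≡b+1+b)
                      (binom2n-k-1-complement (suc b) m (suc (suc k))
                                              (trans (+-suc m (suc k)) (cong suc m+1+k≡b+2+b)))) ⟩
  binom2n-k-1 (suc b) k + binom2n-k-1 (suc (suc b)) (suc (suc k)) ∎
  where
  open ≡-Reasoning
  m = b + suc b ∸ k
  m+k≡b+1+b : m + k ≡ b + suc b
  m+k≡b+1+b = m∸n+n≡m (≤-trans k≤n (m≤n+m (suc b) b))
  m+1+k≡b+2+b : m + suc k ≡ b + suc (suc b)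
  m+1+k≡b+2+b = trans (+-suc m k) (trans (cong suc m+k≡b+1+b) (sym (+-suc b (suc b))))

count-suc-zero : ∀ a → count (suc a) 0 ≡ count (suc a) 1 + count (suc (suc a)) 3
count-suc-zero a = begin
  binom2n-k-1 (suc a) 0            ≡⟨ binom2n-k-1-complement a (a + suc a) 0 (+-identityʳ _) ⟩
  (a + suc a) C a                  ≡⟨ nCk≡nC[n∸k] (m≤m+n a (suc a)) ⟩
  (a + suc a) C (a + suc a ∸ a)    ≡⟨ cong₂ _C_ (+-suc a a) (m+n∸m≡n a (suc a)) ⟩
  suc (a + a) C suc a              ≡⟨ sym (nCk+nC[k+1]≡[n+1]C[k+1] (a + a) a) ⟩
  (a + a) C a + (a + a) C suc a    ≡⟨ sym (cong₂ _+_
                                        (binom2n-k-1-complement a (a + a) 1 (rearrange₁ a))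
                                        (binom2n-k-1-complement (suc a) (a + a) 3 (rearrange₃ a))) ⟩
  binom2n-k-1 (suc a) 1 + binom2n-k-1 (suc (suc a)) 3 ∎
  where
  open ≡-Reasoning
  rearrange₁ : ∀ a → a + a + 1 ≡ a + suc a
  rearrange₁ = solve-∀
  rearrange₃ : ∀ a → a + a + 3 ≡ suc a + suc (suc a)
  rearrange₃ = solve-∀

count-empty : ∀ {n k} → n < k → count n k ≡ 0
count-empty {zero} {suc k} _ = refl
count-empty {suc a} {k} 1+a<k with k ≤? a + suc a
... | yes k≤2a+1 = trans (binom2n-k-1-complement a m k m+k≡2a+1) (k>n⇒nCk≡0 m<a)
  where
  m = a + suc a ∸ k
  m+k≡2a+1 : m + k ≡ a + suc a
  m+k≡2a+1 = m∸n+n≡m k≤2a+1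
  m<a : m < a
  m<a = +-cancelʳ-< (suc a) m a (subst (m + suc a <_) m+k≡2a+1 (+-monoʳ-< m 1+a<k))
... | no k≰2a+1 = binom2n-k-1-≥ (suc a) k (subst (_≤ k) (sym (2*n≡n+n (suc a))) (≰⇒> k≰2a+1))

↔-Fin-+ : {X Y Z : Set} {x y z : ℕ} → x ≡ y + z → X ↔ (Y ⊎ Z) → Y ↔ Fin y → Z ↔ Fin z → X ↔ Fin x
↔-Fin-+ refl X↔Y⊎Z Y↔y Z↔z = ↔-trans X↔Y⊎Z (↔-trans (Y↔y ⊎-↔ Z↔z) (↔-sym +↔⊎))

¬⇒↔Fin : {X : Set} {x : ℕ} → x ≡ 0 → ¬ X → X ↔ Fin x
¬⇒↔Fin refl ¬x = mk↔ₛ′ (λ x → ⊥-elim (¬x x)) (λ ()) (λ ()) (λ x → ⊥-elim (¬x x))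

markedOutdeg↔Fin-empty : ∀ {n k} → n < k → MarkedOutdeg n k ↔ Fin (count n k)
markedOutdeg↔Fin-empty n<k = ¬⇒↔Fin (count-empty n<k) (markedOutdeg-empty n<k)

-- Every recursive call lowers 2n − k by one, so d bounds the depth of the recursion.
markedOutdeg↔Fin-fuel : ∀ d n k → n + n ≤ k + d → MarkedOutdeg n k ↔ Fin (count n k)
markedOutdeg↔Fin-fuel d zero zero _ = markedOutdeg-zero-zero
markedOutdeg↔Fin-fuel d zero (suc k) _ = markedOutdeg↔Fin-empty z<s
markedOutdeg↔Fin-fuel zero (suc a) k 2n≤k+0 =
  markedOutdeg↔Fin-empty
    (≤-trans (m<m+n (suc a) z<s) (subst (suc a + suc a ≤_) (+-identityʳ k) 2n≤k+0))
markedOutdeg↔Fin-fuel (suc d) (suc a) zero 2n≤1+d =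
  ↔-Fin-+ (count-suc-zero a) (markedOutdeg-suc-zero a)
    (markedOutdeg↔Fin-fuel d (suc a) 1 2n≤1+d)
    (markedOutdeg↔Fin-fuel d (suc (suc a)) 3
      (s≤s (s≤s (subst (_≤ suc d) (sym (+-suc a (suc a))) 2n≤1+d))))
markedOutdeg↔Fin-fuel (suc d) (suc a) (suc k) 2n≤k+d with k ≤? a
... | no k≰a  = markedOutdeg↔Fin-empty (s≤s (≰⇒> k≰a))
... | yes k≤a = ↔-Fin-+ (count-suc-suc a k k≤a) (markedOutdeg-suc-suc a k)
    (markedOutdeg↔Fin-fuel d a k (≤-pred (subst₂ _≤_ (+-suc a a) (+-suc k d) (≤-pred 2n≤k+d))))
    (markedOutdeg↔Fin-fuel d (suc a) (suc (suc k))
      (subst (suc a + suc a ≤_) (cong suc (+-suc k d)) 2n≤k+d))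

markedOutdeg↔Fin : ∀ n k → MarkedOutdeg n k ↔ Fin (count n k)
markedOutdeg↔Fin n k = markedOutdeg↔Fin-fuel (n + n) n k (m≤n+m (n + n) k)

corollary2p1 : (n k : ℕ) → 1 ≤ n → 1 ≤ k →
    ((Pairs n (FirstChildDeg k) ↔ Pairs n (NonFirstChildDeg k))
    × (Pairs n (FirstChildDeg k) ↔ Pairs n (LeafElder k))
    × (Pairs n (FirstChildDeg k) ↔ Pairs n (NonLeafOutdeg k)))
    × ((Pairs n (FirstChildDeg k) ↔ Fin (binom2n-k-1 n k))
    × (Pairs n (NonFirstChildDeg k) ↔ Fin (binom2n-k-1 n k))
    × (Pairs n (LeafElder k) ↔ Fin (binom2n-k-1 n k))
    × (Pairs n (NonLeafOutdeg k) ↔ Fin (binom2n-k-1 n k)))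
corollary2p1 (suc n) (suc k) _ _ =
  (↔-trans first (↔-sym nonFirst) , ↔-trans first (↔-sym leaf) , ↔-trans first (↔-sym nonLeaf)) ,
  (↔-trans first counted , ↔-trans nonFirst counted , ↔-trans leaf counted , ↔-trans nonLeaf counted)
  where
  first    = firstChildDeg↔markedOutdeg (suc n) k
  nonFirst = nonFirstChildDeg↔markedOutdeg (suc n) k
  leaf     = leafElder↔markedOutdeg n k
  nonLeaf  = nonLeafOutdeg↔markedOutdeg (suc n) k
  counted  = markedOutdeg↔Fin (suc n) (suc k)
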